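{- Let $d=(d_1,\dots,d_n)$ be a degree sequence (a graphic list), and consider all realizations of $d$ on vertex set $[n]=\{1,\dots,n\}$ in which vertex $\ell$ has degree $d_\ell$ for every $\ell\in[n]$. Let $i,j\in[n]$ with $i<j$. Then $\{i,j\}$ is a forced edge for $d$ if and only if the sequence \[d^+(i,j) = (d_1,\dots,d_{i-1},d_i + 1, d_{i+1}, \dots, d_{j-1}, d_j + 1, d_{j+1},\dots, d_n)\] is not graphic. Moreover, $\{i,j\}$ is a forced non-edge for $d$ if and only if the sequence \[d^-(i,j) = (d_1,\dots,d_{i-1},d_i - 1, d_{i+1}, \dots, d_{j-1}, d_j - 1, d_{j+1},\dots, d_n)\] is not graphic.
   Context: All graphs are finite and simple. A list of integers is graphic if it is the degree sequence of some graph. A realization of $d=(d_1,\dots,d_n)$ is a labeled graph on vertex set $[n]$ in which vertex $\ell$ has degree $d_\ell$; realizations with different edge sets are distinct even if isomorphic. A pair $\{i,j\}$ of distinct vertices is a forced edge for $d$ if $i$ and $j$ are adjacent in every realization of $d$, and a forced non-edge if they are adjacent in no realization of $d$. Throughout, $d_1\ge d_2\ge\dots\ge d_n$. -}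

module Defs where

open import Data.Nat using (ℕ; _<_; _≥_)
open import Data.Integer using (ℤ; +_; _+_; _-_; 1ℤ)
open import Data.Bool using (Bool; true; false)
open import Data.Fin using (Fin; toℕ)
open import Data.Fin.Properties using (_≟_)
open import Data.List using (List; filterᵇ; length)
open import Data.List using () renaming (allFin to allFinL)
open import Data.Product using (Σ; _×_)
open import Relation.Binary.PropositionalEquality using (_≡_)
open import Relation.Nullary using (¬_)
open import Relation.Nullary.Decidable using (⌊_⌋)

record Graph (n : ℕ) : Set where
  field
    adj        : Fin n → Fin n → Bool
    symmetric  : ∀ i j → adj i j ≡ adj j i
    irreflexive : ∀ i → adj i i ≡ false
open Graph public

degree : ∀ {n} → Graph n → Fin n → ℕ
degree G v = length (filterᵇ (adj G v) (allFinL _))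

-- Integer lists (so that d_i - 1 makes sense even if d_i = 0).
Seq : ℕ → Set
Seq n = Fin n → ℤ

Realizes : ∀ {n} → Graph n → Seq n → Set
Realizes G d = ∀ ℓ → + degree G ℓ ≡ d ℓ

Realization : ∀ {n} → Seq n → Set
Realization {n} d = Σ (Graph n) λ G → Realizes G d

Graphic : ∀ {n} → Seq n → Set
Graphic d = Realization d

NonIncreasing : ∀ {n} → Seq n → Set
NonIncreasing {n} d = ∀ (a b : Fin n) → toℕ a < toℕ b → d b Data.Integer.≤ d a

ForcedEdge : ∀ {n} → Seq n → Fin n → Fin n → Set
ForcedEdge d i j = ∀ (R : Realization d) → adj (Data.Product.proj₁ R) i j ≡ true

ForcedNonEdge : ∀ {n} → Seq n → Fin n → Fin n → Set
ForcedNonEdge d i j = ∀ (R : Realization d) → adj (Data.Product.proj₁ R) i j ≡ false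

bump : ∀ {n} → ℤ → Seq n → Fin n → Fin n → Seq n
bump c d i j ℓ with ⌊ ℓ ≟ i ⌋ | ⌊ ℓ ≟ j ⌋
... | true  | _     = d ℓ + c
... | false | true  = d ℓ + c
... | false | false = d ℓ

d⁺ : ∀ {n} → Seq n → Fin n → Fin n → Seq n
d⁺ = bump 1ℤ

d⁻ : ∀ {n} → Seq n → Fin n → Fin n → Seq n
d⁻ = bump (Data.Integer.- 1ℤ)

module Submission where

-- The easy halves are local edits: if some realization of d avoids ij, adding
-- ij realizes d⁺(i,j); if some realization contains ij, deleting it realizes
-- d⁻(i,j).  The hard halves rest on an exchange lemma: if graphs A and B have
-- degrees a and a + 1_x + 1_y, then some graph with the degrees of A avoids xy.
-- It is proved for a pair of such graphs at minimal distance (the number of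
-- ordered vertex pairs on which they disagree): colour B∖A red and A∖B blue.
-- Counting degrees, every vertex on an edge of one colour lies on an edge of
-- the other, so alternating walks go on forever and eventually close up; but
-- minimality, through degree-preserving 2-switches, lets every closed
-- alternating walk be shortcut until it degenerates, a contradiction.
-- The forced-edge claim applies the lemma to G realizing d and H realizing
-- d⁺; the forced-non-edge claim to H realizing d⁻ and G.

open import Defs
open import Data.Nat using (ℕ; _<_; zero; suc; _+_; _*_; _∸_; _≤_; z≤n; s≤s)
open import Data.Fin using (Fin; toℕ; zero; suc; punchIn)
open import Data.Product using (_×_; Σ; ∃; _,_; proj₁; proj₂)
open import Relation.Nullary using (¬_; Dec; yes; no; _×-dec_)
open import Function.Bundles using (_⇔_; mk⇔; module Equivalence)

open import Data.Nat.Properties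
  using (+-0-commutativeMonoid; +-comm; +-assoc; +-suc; +-identityʳ; *-identityʳ;
         *-zeroʳ; *-distribʳ-+; +-cancelʳ-≡; m∸n+n≡m; ≤-refl; ≤-trans; ≤-reflexive; <-irrefl;
         <-≤-trans; n<1+n; m≤m+n; m<m+n; +-mono-≤; +-monoˡ-≤; +-mono-<-≤; module ≤-Reasoning)
open import Data.Nat.Tactic.RingSolver using (solve-∀)
open import Data.Nat.Induction using (<-wellFounded)
open import Data.Bool using (Bool; true; false; not; _∧_; _∨_; _xor_)
open import Data.Bool.Properties using (∨-comm; ∧-comm; xor-comm; xor-assoc) renaming (_≟_ to _≟ᵇ_)
open import Data.Fin.Properties using (_≟_; punchInᵢ≢i; any?; pigeonhole)
open import Data.List using (filterᵇ; length; tabulate)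
open import Data.Empty using (⊥; ⊥-elim)
open import Data.Sum using (_⊎_; inj₁; inj₂)
open import Function using (_∘_)
open import Relation.Binary.PropositionalEquality
open import Relation.Nullary.Decidable using (⌊_⌋; isYes≗does; dec-true; dec-false)
open import Induction.WellFounded using (Acc; acc)
open import Algebra.Properties.CommutativeMonoid.Sum +-0-commutativeMonoid
  using (sum; sum-cong-≗; sum-remove; sum-replicate-zero; ∑-distrib-+)
import Data.Integer as ℤ
import Data.Integer.Properties as ℤ
open import Algebra.Properties.AbelianGroup ℤ.+-0-abelianGroup using (∙-cancelʳ)

false≢true : false ≢ true
false≢true ()

bit : Bool → ℕ
bit true  = 1
bit false = 0

count : ∀ {n} → (Fin n → Bool) → ℕ
count f = sum (bit ∘ f)

length-filter-tabulate : ∀ {a} {A : Set a} m (p : A → Bool) (h : Fin m → A) →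
  length (filterᵇ p (tabulate h)) ≡ count (p ∘ h)
length-filter-tabulate zero    p h = refl
length-filter-tabulate (suc m) p h with p (h zero)
... | true  = cong suc (length-filter-tabulate m p (h ∘ suc))
... | false = length-filter-tabulate m p (h ∘ suc)

degree≡count : ∀ {n} (G : Graph n) v → degree G v ≡ count (adj G v)
degree≡count {n} G v = length-filter-tabulate n (adj G v) (λ u → u)

sum-update : ∀ {n} (f g : Fin n → ℕ) y → (∀ v → v ≢ y → f v ≡ g v) →
  sum f + g y ≡ sum g + f y
sum-update {suc n} f g y same = begin
  sum f + g y                      ≡⟨ cong (_+ g y) (sum-remove f) ⟩
  f y + sum (f ∘ punchIn y) + g y  ≡⟨ cong (λ s → f y + s + g y) (sum-cong-≗ sameOff) ⟩
  f y + sum (g ∘ punchIn y) + g y  ≡⟨ swap-ends (f y) _ (g y) ⟩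
  g y + sum (g ∘ punchIn y) + f y  ≡⟨ cong (_+ f y) (sum-remove g) ⟨
  sum g + f y                      ∎
  where
  open ≡-Reasoning
  sameOff : ∀ v → f (punchIn y v) ≡ g (punchIn y v)
  sameOff v = same (punchIn y v) (punchInᵢ≢i y v)
  swap-ends : ∀ a b c → a + b + c ≡ c + b + a
  swap-ends = solve-∀

sum-mono : ∀ {n} {f g : Fin n → ℕ} → (∀ v → f v ≤ g v) → sum f ≤ sum g
sum-mono {zero}  f≤g = z≤n
sum-mono {suc n} f≤g = +-mono-≤ (f≤g zero) (sum-mono (f≤g ∘ suc))

sum-mono-< : ∀ {n} {f g : Fin n → ℕ} → (∀ v → f v ≤ g v) → ∀ w → f w < g w → sum f < sum g
sum-mono-< {suc n} {f} {g} f≤g w fw<gw = begin-strict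
  sum f                       ≡⟨ sum-remove f ⟩
  f w + sum (f ∘ punchIn w)   <⟨ +-mono-<-≤ fw<gw (sum-mono (f≤g ∘ punchIn w)) ⟩
  g w + sum (g ∘ punchIn w)   ≡⟨ sum-remove g ⟨
  sum g                       ∎
  where open ≤-Reasoning

count-witness : ∀ {n} (f g : Fin n → Bool) w → g w ≡ true → f w ≡ false →
  count g ≤ count f → ∃ λ v → f v ≡ true × g v ≡ false
count-witness f g w gw fw g≤f with any? (λ v → (f v ≟ᵇ true) ×-dec (g v ≟ᵇ false))
... | yes witness = witness
... | no none = ⊥-elim (<-irrefl refl (<-≤-trans f<g g≤f))
  where
  f⊆g : ∀ v → bit (f v) ≤ bit (g v)
  f⊆g v with f v in fv | g v in gv
  ... | false | _     = z≤n
  ... | true  | true  = ≤-refl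
  ... | true  | false = ⊥-elim (none (v , fv , gv))
  f<g : count f < count g
  f<g = sum-mono-< f⊆g w (subst₂ (λ a b → bit a < bit b) (sym fw) (sym gw) (s≤s z≤n))

isPair : ∀ {n} → Fin n → Fin n → Fin n → Fin n → Bool
isPair x y u v = (⌊ u ≟ x ⌋ ∧ ⌊ v ≟ y ⌋) ∨ (⌊ u ≟ y ⌋ ∧ ⌊ v ≟ x ⌋)

isPair-swap : ∀ {n} (x y u v : Fin n) → isPair x y u v ≡ isPair x y v u
isPair-swap x y u v = trans (∨-comm (⌊ u ≟ x ⌋ ∧ ⌊ v ≟ y ⌋) _)
                            (cong₂ _∨_ (∧-comm ⌊ u ≟ y ⌋ _) (∧-comm ⌊ u ≟ x ⌋ _))

isPair-sym : ∀ {n} (x y u v : Fin n) → isPair x y u v ≡ isPair y x u v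
isPair-sym x y u v = ∨-comm (⌊ u ≟ x ⌋ ∧ ⌊ v ≟ y ⌋) _

isPair-self : ∀ {n} (x y : Fin n) → isPair x y x y ≡ true
isPair-self x y with x ≟ x | y ≟ y
... | yes _ | yes _ = refl
... | no x≢x | _     = ⊥-elim (x≢x refl)
... | yes _ | no y≢y = ⊥-elim (y≢y refl)

isPair-outside : ∀ {n} {x y u : Fin n} v → u ≢ x → u ≢ y → isPair x y u v ≡ false
isPair-outside {x = x} {y} {u} v u≢x u≢y with u ≟ x | u ≟ y
... | yes u≡x | _     = ⊥-elim (u≢x u≡x)
... | no _    | yes u≡y = ⊥-elim (u≢y u≡y)
... | no _    | no _    = refl

isPair-outsideʳ : ∀ {n} {x y v : Fin n} u → v ≢ x → v ≢ y → isPair x y u v ≡ false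
isPair-outsideʳ {x = x} {y} {v} u v≢x v≢y = trans (isPair-swap x y u v) (isPair-outside u v≢x v≢y)

isPair-loop : ∀ {n} {x y : Fin n} → x ≢ y → ∀ u → isPair x y u u ≡ false
isPair-loop {x = x} {y} x≢y u with u ≟ x | u ≟ y
... | yes refl | yes refl = ⊥-elim (x≢y refl)
... | yes _    | no _     = refl
... | no _     | yes _    = refl
... | no _     | no _     = refl

isPair-row : ∀ {n} {x y : Fin n} → x ≢ y → ∀ v → v ≢ y → isPair x y x v ≡ false
isPair-row {x = x} {y} x≢y v v≢y with x ≟ x | v ≟ y | x ≟ y
... | no x≢x | _       | _       = ⊥-elim (x≢x refl)
... | yes _  | yes v≡y | _       = ⊥-elim (v≢y v≡y)
... | yes _  | no _    | yes x≡y = ⊥-elim (x≢y x≡y)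
... | yes _  | no _    | no _    = refl

Matrix : ℕ → Set
Matrix n = Fin n → Fin n → Bool

SymmetricMatrix : ∀ {n} → Matrix n → Set
SymmetricMatrix F = ∀ u v → F u v ≡ F v u

toggle : ∀ {n} → Fin n → Fin n → Matrix n → Matrix n
toggle x y F u v = isPair x y u v xor F u v

-- The number of endpoints of {x, y} equal to u: the indicator of {x, y} when x ≢ y.
ends : ∀ {n} → Fin n → Fin n → Fin n → ℕ
ends x y u = bit ⌊ u ≟ x ⌋ + bit ⌊ u ≟ y ⌋

count-toggle-end : ∀ {n} (F : Matrix n) {x y} → x ≢ y →
  count (toggle x y F x) + bit (F x y) ≡ count (F x) + bit (not (F x y))
count-toggle-end F {x} {y} x≢y = sym (begin
  count (F x) + bit (not (F x y))              ≡⟨ cong (λ b → count (F x) + bit (b xor F x y)) (isPair-self x y) ⟨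
  count (F x) + bit (toggle x y F x y)         ≡⟨ sum-update (bit ∘ F x) (bit ∘ toggle x y F x) y offColumn ⟩
  count (toggle x y F x) + bit (F x y)         ∎)
  where
  open ≡-Reasoning
  offColumn : ∀ v → v ≢ y → bit (F x v) ≡ bit (toggle x y F x v)
  offColumn v v≢y = cong (λ b → bit (b xor F x v)) (sym (isPair-row x≢y v v≢y))

ends-first : ∀ {n} {x y : Fin n} → x ≢ y → ends x y x ≡ 1
ends-first {x = x} {y} x≢y with x ≟ x | x ≟ y
... | yes _  | no _     = refl
... | _      | yes x≡y  = ⊥-elim (x≢y x≡y)
... | no x≢x | _        = ⊥-elim (x≢x refl)

ends-second : ∀ {n} {x y : Fin n} → x ≢ y → ends x y y ≡ 1
ends-second {x = x} {y} x≢y = trans (+-comm (bit ⌊ y ≟ x ⌋) _) (ends-first (x≢y ∘ sym))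

ends-outside : ∀ {n} {x y u : Fin n} → u ≢ x → u ≢ y → ends x y u ≡ 0
ends-outside {x = x} {y} {u} u≢x u≢y with u ≟ x | u ≟ y
... | yes u≡x | _       = ⊥-elim (u≢x u≡x)
... | no _    | yes u≡y = ⊥-elim (u≢y u≡y)
... | no _    | no _    = refl

count-toggle : ∀ {n} (F : Matrix n) → SymmetricMatrix F → ∀ {x y} → x ≢ y → ∀ u →
  count (toggle x y F u) + ends x y u * bit (F x y) ≡ count (F u) + ends x y u * bit (not (F x y))
count-toggle F F-sym {x} {y} x≢y u = byCases (u ≟ x) (u ≟ y)
  where
  open ≡-Reasoning
  Goal : Fin _ → Set
  Goal w = count (toggle x y F w) + ends x y w * bit (F x y) ≡ count (F w) + ends x y w * bit (not (F x y))
  byCases : Dec (u ≡ x) → Dec (u ≡ y) → Goal u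
  byCases (yes refl) _
    rewrite ends-first x≢y | +-identityʳ (bit (F x y)) | +-identityʳ (bit (not (F x y))) = count-toggle-end F x≢y
  byCases (no _) (yes refl)
    rewrite ends-second x≢y | +-identityʳ (bit (F x y)) | +-identityʳ (bit (not (F x y))) = begin
    count (toggle x y F y) + bit (F x y)   ≡⟨ cong₂ _+_ sameRow (cong bit (F-sym x y)) ⟩
    count (toggle y x F y) + bit (F y x)   ≡⟨ count-toggle-end F (x≢y ∘ sym) ⟩
    count (F y) + bit (not (F y x))        ≡⟨ cong (λ b → count (F y) + bit (not b)) (F-sym y x) ⟩
    count (F y) + bit (not (F x y))        ∎
    where
    sameRow : count (toggle x y F y) ≡ count (toggle y x F y)
    sameRow = sum-cong-≗ λ v → cong (λ b → bit (b xor F y v)) (isPair-sym x y y v)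
  byCases (no u≢x) (no u≢y) rewrite ends-outside u≢x u≢y = cong (_+ 0) (sum-cong-≗ unchanged)
    where
    unchanged : ∀ v → bit (toggle x y F u v) ≡ bit (F u v)
    unchanged v = cong (λ b → bit (b xor F u v)) (isPair-outside v u≢x u≢y)

toggleEdge : ∀ {n} (G : Graph n) (x y : Fin n) → x ≢ y → Graph n
adj (toggleEdge G x y x≢y) = toggle x y (adj G)
symmetric (toggleEdge G x y x≢y) u v = cong₂ _xor_ (isPair-swap x y u v) (symmetric G u v)
irreflexive (toggleEdge G x y x≢y) u = cong₂ _xor_ (isPair-loop x≢y u) (irreflexive G u)

toggleEdge-pair : ∀ {n} (G : Graph n) x y (x≢y : x ≢ y) → adj (toggleEdge G x y x≢y) x y ≡ not (adj G x y)
toggleEdge-pair G x y x≢y = cong (_xor adj G x y) (isPair-self x y)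

toggleEdge-other : ∀ {n} (G : Graph n) x y (x≢y : x ≢ y) {u v} → isPair x y u v ≡ false →
  adj (toggleEdge G x y x≢y) u v ≡ adj G u v
toggleEdge-other G x y x≢y {u} {v} other = cong (_xor adj G u v) other

degree-toggle : ∀ {n} (G : Graph n) {x y} (x≢y : x ≢ y) → ∀ u →
  degree (toggleEdge G x y x≢y) u + ends x y u * bit (adj G x y)
    ≡ degree G u + ends x y u * bit (not (adj G x y))
degree-toggle G {x} {y} x≢y u =
  subst₂ (λ k l → k + ends x y u * bit (adj G x y) ≡ l + ends x y u * bit (not (adj G x y)))
         (sym (degree≡count (toggleEdge G x y x≢y) u)) (sym (degree≡count G u))
         (count-toggle (adj G) (symmetric G) x≢y u)

degree-remove : ∀ {n} (G : Graph n) {x y} (x≢y : x ≢ y) → adj G x y ≡ true →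
  ∀ u → degree (toggleEdge G x y x≢y) u + ends x y u ≡ degree G u
degree-remove G {x} {y} x≢y xy∈G u = begin
  degree G′ u + e                         ≡⟨ cong (degree G′ u +_) (*-identityʳ e) ⟨
  degree G′ u + e * 1                     ≡⟨ cong (λ b → degree G′ u + e * bit b) xy∈G ⟨
  degree G′ u + e * bit (adj G x y)       ≡⟨ degree-toggle G x≢y u ⟩
  degree G u + e * bit (not (adj G x y))  ≡⟨ cong (λ b → degree G u + e * bit (not b)) xy∈G ⟩
  degree G u + e * 0                      ≡⟨ cong (degree G u +_) (*-zeroʳ e) ⟩
  degree G u + 0                          ≡⟨ +-identityʳ _ ⟩
  degree G u                              ∎
  where
  open ≡-Reasoning
  G′ = toggleEdge G x y x≢y
  e = ends x y u

degree-add : ∀ {n} (G : Graph n) {x y} (x≢y : x ≢ y) → adj G x y ≡ false →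
  ∀ u → degree (toggleEdge G x y x≢y) u ≡ degree G u + ends x y u
degree-add G {x} {y} x≢y xy∉G u = begin
  degree G′ u                             ≡⟨ +-identityʳ _ ⟨
  degree G′ u + 0                         ≡⟨ cong (degree G′ u +_) (*-zeroʳ e) ⟨
  degree G′ u + e * 0                     ≡⟨ cong (λ b → degree G′ u + e * bit b) xy∉G ⟨
  degree G′ u + e * bit (adj G x y)       ≡⟨ degree-toggle G x≢y u ⟩
  degree G u + e * bit (not (adj G x y))  ≡⟨ cong (λ b → degree G u + e * bit (not b)) xy∉G ⟩
  degree G u + e * 1                      ≡⟨ cong (degree G u +_) (*-identityʳ e) ⟩
  degree G u + e                          ∎
  where
  open ≡-Reasoning
  G′ = toggleEdge G x y x≢y
  e = ends x y u

sum-*ʳ : ∀ {n} (f : Fin n → ℕ) c → sum (λ u → f u * c) ≡ sum f * c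
sum-*ʳ {zero}  f c = refl
sum-*ʳ {suc n} f c = trans (cong (f zero * c +_) (sum-*ʳ (f ∘ suc) c)) (sym (*-distribʳ-+ c (f zero) _))

count-point : ∀ {n} (x : Fin n) → count (λ u → ⌊ u ≟ x ⌋) ≡ 1
count-point {n} x = begin
  count isX                             ≡⟨ +-identityʳ (count isX) ⟨
  count isX + 0                         ≡⟨ sum-update (bit ∘ isX) (λ _ → 0) x offX ⟩
  sum {n} (λ _ → 0) + bit (isX x)       ≡⟨ cong₂ _+_ (sum-replicate-zero n) (cong bit onX) ⟩
  1                                     ∎
  where
  open ≡-Reasoning
  isX : Fin n → Bool
  isX u = ⌊ u ≟ x ⌋
  onX : isX x ≡ true
  onX = trans (isYes≗does (x ≟ x)) (dec-true (x ≟ x) refl)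
  offX : ∀ v → v ≢ x → bit (isX v) ≡ 0
  offX v v≢x = cong bit (trans (isYes≗does (v ≟ x)) (dec-false (v ≟ x) v≢x))

sum-ends : ∀ {n} (x y : Fin n) → sum (ends x y) ≡ 2
sum-ends x y = trans (∑-distrib-+ (bit ∘ λ u → ⌊ u ≟ x ⌋) (bit ∘ λ u → ⌊ u ≟ y ⌋))
                     (cong₂ _+_ (count-point x) (count-point y))

disagreement : ∀ {n} → Graph n → Graph n → Matrix n
disagreement M N u v = adj M u v xor adj N u v

-- The number of ordered vertex pairs on which M and N disagree; it is twice
-- the size of the symmetric difference of their edge sets.
distance : ∀ {n} → Graph n → Graph n → ℕ
distance M N = sum (λ u → count (disagreement M N u))

Disagree : ∀ {n} → Graph n → Graph n → Fin n → Fin n → Set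
Disagree M N x y = disagreement M N x y ≡ true

distance-sym : ∀ {n} (M N : Graph n) → distance M N ≡ distance N M
distance-sym M N = sum-cong-≗ λ u → sum-cong-≗ λ v → cong bit (xor-comm (adj M u v) (adj N u v))

distance-toggle : ∀ {n} (M N : Graph n) {x y} (x≢y : x ≢ y) →
  distance (toggleEdge M x y x≢y) N + 2 * bit (disagreement M N x y)
    ≡ distance M N + 2 * bit (not (disagreement M N x y))
distance-toggle M N {x} {y} x≢y = begin
  distance M′ N + 2 * bit (F x y)
    ≡⟨ cong₂ _+_ toggled-disagreement (cong (_* bit (F x y)) (sum-ends x y)) ⟨
  sum (λ u → count (toggle x y F u)) + sum (ends x y) * bit (F x y)
    ≡⟨ cong (sum (λ u → count (toggle x y F u)) +_) (sum-*ʳ (ends x y) _) ⟨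
  sum (λ u → count (toggle x y F u)) + sum (λ u → ends x y u * bit (F x y))
    ≡⟨ ∑-distrib-+ (λ u → count (toggle x y F u)) _ ⟨
  sum (λ u → count (toggle x y F u) + ends x y u * bit (F x y))
    ≡⟨ sum-cong-≗ (count-toggle F F-sym x≢y) ⟩
  sum (λ u → count (F u) + ends x y u * bit (not (F x y)))
    ≡⟨ ∑-distrib-+ (λ u → count (F u)) _ ⟩
  distance M N + sum (λ u → ends x y u * bit (not (F x y)))
    ≡⟨ cong (distance M N +_) (trans (sum-*ʳ (ends x y) _) (cong (_* bit (not (F x y))) (sum-ends x y))) ⟩
  distance M N + 2 * bit (not (F x y))
    ∎
  where
  open ≡-Reasoning
  M′ = toggleEdge M x y x≢y
  F = disagreement M N
  F-sym : SymmetricMatrix F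
  F-sym u v = cong₂ _xor_ (symmetric M u v) (symmetric N u v)
  toggled-disagreement : sum (λ u → count (toggle x y F u)) ≡ distance M′ N
  toggled-disagreement = sum-cong-≗ λ u → sum-cong-≗ λ v →
    cong bit (sym (xor-assoc (isPair x y u v) (adj M u v) (adj N u v)))

distance-toggle-disagree : ∀ {n} (M N : Graph n) {x y} (x≢y : x ≢ y) → Disagree M N x y →
  distance (toggleEdge M x y x≢y) N + 2 ≡ distance M N
distance-toggle-disagree M N {x} {y} x≢y dis = begin
  distance M′ N + 2                                    ≡⟨ cong (λ b → distance M′ N + 2 * bit b) dis ⟨
  distance M′ N + 2 * bit (disagreement M N x y)       ≡⟨ distance-toggle M N x≢y ⟩
  distance M N + 2 * bit (not (disagreement M N x y))  ≡⟨ cong (λ b → distance M N + 2 * bit (not b)) dis ⟩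
  distance M N + 0                                     ≡⟨ +-identityʳ _ ⟩
  distance M N                                         ∎
  where
  open ≡-Reasoning
  M′ = toggleEdge M x y x≢y

distance-toggle-agree : ∀ {n} (M N : Graph n) {x y} (x≢y : x ≢ y) → disagreement M N x y ≡ false →
  distance (toggleEdge M x y x≢y) N ≡ distance M N + 2
distance-toggle-agree M N {x} {y} x≢y agree = begin
  distance M′ N                                        ≡⟨ +-identityʳ _ ⟨
  distance M′ N + 0                                    ≡⟨ cong (λ b → distance M′ N + 2 * bit b) agree ⟨
  distance M′ N + 2 * bit (disagreement M N x y)       ≡⟨ distance-toggle M N x≢y ⟩
  distance M N + 2 * bit (not (disagreement M N x y))  ≡⟨ cong (λ b → distance M N + 2 * bit (not b)) agree ⟩
  distance M N + 2                                     ∎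
  where
  open ≡-Reasoning
  M′ = toggleEdge M x y x≢y

distance-toggle-≤ : ∀ {n} (M N : Graph n) {x y} (x≢y : x ≢ y) →
  distance (toggleEdge M x y x≢y) N ≤ distance M N + 2
distance-toggle-≤ M N {x} {y} x≢y with disagreement M N x y in dis
... | true  = ≤-trans (m≤m+n _ 2) (≤-trans (≤-reflexive (distance-toggle-disagree M N x≢y dis)) (m≤m+n _ 2))
... | false = ≤-reflexive (distance-toggle-agree M N x≢y dis)

edge-distinct : ∀ {n} (G : Graph n) {u v} → adj G u v ≡ true → u ≢ v
edge-distinct G {u} uv∈G refl = false≢true (trans (sym (irreflexive G u)) uv∈G)

record Square {n} (M : Graph n) (a b c d : Fin n) : Set where
  field
    ab∈M : adj M a b ≡ true
    cd∈M : adj M c d ≡ true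
    bc∉M : adj M b c ≡ false
    ad∉M : adj M a d ≡ false
    b≢c  : b ≢ c
    a≢d  : a ≢ d

-- The 2-switch on a square replaces the edges ab, cd by bc, ad.
module Switch {n} {M : Graph n} {a b c d : Fin n} (sq : Square M a b c d) where
  open Square sq

  a≢b : a ≢ b
  a≢b = edge-distinct M ab∈M

  c≢d : c ≢ d
  c≢d = edge-distinct M cd∈M

  a≢c : a ≢ c
  a≢c refl = false≢true (trans (sym bc∉M) (trans (symmetric M b a) ab∈M))

  b≢d : b ≢ d
  b≢d refl = false≢true (trans (sym ad∉M) ab∈M)

  M₁ M₂ M₃ switched : Graph n
  M₁ = toggleEdge M a b a≢b
  M₂ = toggleEdge M₁ c d c≢d
  M₃ = toggleEdge M₂ b c b≢c
  switched = toggleEdge M₃ a d a≢d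

  cd-before : adj M₁ c d ≡ adj M c d
  cd-before = toggleEdge-other M a b a≢b {c} {d} (isPair-outside d (a≢c ∘ sym) (b≢c ∘ sym))

  bc-before : adj M₂ b c ≡ adj M b c
  bc-before = trans (toggleEdge-other M₁ c d c≢d {b} {c} (isPair-outside c b≢c b≢d))
                    (toggleEdge-other M a b a≢b {b} {c} (isPair-outsideʳ b (a≢c ∘ sym) (b≢c ∘ sym)))

  ad-before : adj M₃ a d ≡ adj M a d
  ad-before = trans (toggleEdge-other M₂ b c b≢c {a} {d} (isPair-outside d a≢b a≢c))
             (trans (toggleEdge-other M₁ c d c≢d {a} {d} (isPair-outside d a≢c a≢d))
                    (toggleEdge-other M a b a≢b {a} {d} (isPair-outsideʳ a (a≢d ∘ sym) (b≢d ∘ sym))))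

  switch-degree : ∀ u → degree switched u ≡ degree M u
  switch-degree u = +-cancelʳ-≡ _ _ _ (begin
    degree switched u + (ends a b u + ends c d u)
      ≡⟨ cong (_+ (ends a b u + ends c d u)) (degree-add M₃ a≢d (trans ad-before ad∉M) u) ⟩
    degree M₃ u + ends a d u + (ends a b u + ends c d u)
      ≡⟨ cong (λ k → k + ends a d u + (ends a b u + ends c d u)) (degree-add M₂ b≢c (trans bc-before bc∉M) u) ⟩
    degree M₂ u + ends b c u + ends a d u + (ends a b u + ends c d u)
      ≡⟨ regroup (degree M₂ u) (ends b c u) (ends a d u) (ends a b u) (ends c d u) ⟩
    degree M₂ u + ends c d u + ends a b u + (ends b c u + ends a d u)
      ≡⟨ cong (λ k → k + ends a b u + (ends b c u + ends a d u)) (degree-remove M₁ c≢d (trans cd-before cd∈M) u) ⟩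
    degree M₁ u + ends a b u + (ends b c u + ends a d u)
      ≡⟨ cong (_+ (ends b c u + ends a d u)) (degree-remove M a≢b ab∈M u) ⟩
    degree M u + (ends b c u + ends a d u)
      ≡⟨ cong (degree M u +_) (square-ends (bit ⌊ u ≟ a ⌋) (bit ⌊ u ≟ b ⌋) (bit ⌊ u ≟ c ⌋) _) ⟨
    degree M u + (ends a b u + ends c d u)
      ∎)
    where
    open ≡-Reasoning
    regroup : ∀ k p q r s → k + p + q + (r + s) ≡ k + s + r + (p + q)
    regroup = solve-∀
    -- Every vertex of the square is an endpoint of one switched-out and one switched-in pair.
    square-ends : ∀ p q r s → (p + q) + (r + s) ≡ (q + r) + (p + s)
    square-ends = solve-∀

  module _ (N : Graph n) where
    toggle-ab : Disagree M N a b → distance M₁ N + 2 ≡ distance M N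
    toggle-ab = distance-toggle-disagree M N a≢b

    toggle-cd : Disagree M N c d → distance M₂ N + 2 ≡ distance M₁ N
    toggle-cd cd≠ = distance-toggle-disagree M₁ N c≢d (trans (cong (_xor adj N c d) cd-before) cd≠)

    toggle-bc : Disagree M N b c → distance M₃ N + 2 ≡ distance M₂ N
    toggle-bc bc≠ = distance-toggle-disagree M₂ N b≢c (trans (cong (_xor adj N b c) bc-before) bc≠)

    toggle-ad : Disagree M N a d → distance switched N + 2 ≡ distance M₃ N
    toggle-ad ad≠ = distance-toggle-disagree M₃ N a≢d (trans (cong (_xor adj N a d) ad-before) ad≠)

  switch-distance : ∀ N → Disagree M N a b → Disagree M N b c → Disagree M N c d ⊎ Disagree M N a d →
    distance switched N < distance M N
  switch-distance N ab≠ bc≠ (inj₁ cd≠) = begin-strict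
    distance switched N            <⟨ m<m+n _ {4} (s≤s z≤n) ⟩
    distance switched N + 4        ≤⟨ +-monoˡ-≤ 4 (distance-toggle-≤ M₃ N a≢d) ⟩
    distance M₃ N + 2 + 4          ≡⟨ +-assoc (distance M₃ N + 2) 2 2 ⟨
    distance M₃ N + 2 + 2 + 2      ≡⟨ cong (λ k → k + 2 + 2) (toggle-bc N bc≠) ⟩
    distance M₂ N + 2 + 2          ≡⟨ cong (_+ 2) (toggle-cd N cd≠) ⟩
    distance M₁ N + 2              ≡⟨ toggle-ab N ab≠ ⟩
    distance M N                   ∎
    where open ≤-Reasoning
  switch-distance N ab≠ bc≠ (inj₂ ad≠) = begin-strict
    distance switched N            <⟨ m<m+n _ {4} (s≤s z≤n) ⟩
    distance switched N + 4        ≡⟨ +-assoc (distance switched N) 2 2 ⟨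
    distance switched N + 2 + 2    ≡⟨ cong (_+ 2) (toggle-ad N ad≠) ⟩
    distance M₃ N + 2              ≡⟨ toggle-bc N bc≠ ⟩
    distance M₂ N                  ≤⟨ distance-toggle-≤ M₁ N c≢d ⟩
    distance M₁ N + 2              ≡⟨ toggle-ab N ab≠ ⟩
    distance M N                   ∎
    where open ≤-Reasoning

module AlternatingWalks {n} (Red Blue : Fin n → Fin n → Set)
  (red-sym    : ∀ {x y} → Red x y → Red y x)
  (blue-sym   : ∀ {x y} → Blue x y → Blue y x)
  (disjoint   : ∀ {x y} → Red x y → Blue x y → ⊥)
  (shortcut-red  : ∀ {x y z w} → Red x y → Blue y z → Red z w → x ≢ w → Red x w)
  (shortcut-blue : ∀ {x y z w} → Blue x y → Red y z → Blue z w → x ≢ w → Blue x w)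
  where

  Step : ℕ → Fin n → Fin n → Set
  Step zero          = Red
  Step (suc zero)    = Blue
  Step (suc (suc t)) = Step t

  Alternating : (ℕ → Fin n) → Set
  Alternating w = ∀ t → Step t (w t) (w (suc t))

  twice : ℕ → ℕ
  twice zero    = zero
  twice (suc m) = suc (suc (twice m))

  -- An alternating walk never returns to its start after an even number of
  -- steps: shortcutting removes two steps at a time, until a red and a blue
  -- edge would join the same two vertices.
  no-closed-walk : ∀ m (w : ℕ → Fin n) → Alternating w → w (twice (suc m)) ≡ w 0 → ⊥
  no-closed-walk zero w alt closed = disjoint (alt 0) (blue-sym (subst (Blue (w 1)) closed (alt 1)))
  no-closed-walk (suc m) w alt closed with w 0 ≟ w 3
  ... | no w₀≢w₃ = no-closed-walk m w′ alt′ closed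
    where
    w′ : ℕ → Fin n
    w′ zero    = w 0
    w′ (suc t) = w (3 + t)
    alt′ : Alternating w′
    alt′ zero    = shortcut-red (alt 0) (alt 1) (alt 2) w₀≢w₃
    alt′ (suc t) = alt (3 + t)
  ... | yes w₀≡w₃ with w 1 ≟ w 4
  ...   | no w₁≢w₄ = no-closed-walk m w′ alt′ closed
    where
    w′ : ℕ → Fin n
    w′ zero          = w 0
    w′ (suc zero)    = w 1
    w′ (suc (suc t)) = w (4 + t)
    alt′ : Alternating w′
    alt′ zero          = alt 0
    alt′ (suc zero)    = shortcut-blue (alt 1) (alt 2) (alt 3) w₁≢w₄
    alt′ (suc (suc t)) = alt (4 + t)
  ...   | yes w₁≡w₄ = disjoint (alt 0) (subst₂ Blue (sym w₀≡w₃) (sym w₁≡w₄) (alt 3))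

  -- If every vertex on a red edge also lies on a blue edge and vice versa,
  -- there is no red edge: from one, an alternating walk could be continued
  -- forever, and by the pigeonhole principle it would close up.
  no-red-edge : (∀ {v x} → Red v x → ∃ (Blue v)) → (∀ {v x} → Blue v x → ∃ (Red v)) →
    ∀ {v x} → Red v x → ⊥
  no-red-edge red→blue blue→red {v} {x} v-x = no-closed-walk m (walkFrom p) (walkFrom-alternating p) closed
    where
    -- The walk is built from consecutive red edges, each reached from the
    -- previous one through a blue edge.
    RedEdge : Set
    RedEdge = Σ (Fin n) λ y → ∃ (Red y)

    next : RedEdge → RedEdge
    next (_ , _ , y-z) = let (u , z-u) = red→blue (red-sym y-z) in u , blue→red (blue-sym z-u)

    edge : ℕ → RedEdge
    edge zero    = v , x , v-x
    edge (suc k) = next (edge k)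

    walkFrom : ℕ → ℕ → Fin n
    walkFrom k zero          = proj₁ (edge k)
    walkFrom k (suc zero)    = proj₁ (proj₂ (edge k))
    walkFrom k (suc (suc t)) = walkFrom (suc k) t

    walkFrom-alternating : ∀ k → Alternating (walkFrom k)
    walkFrom-alternating k zero          = proj₂ (proj₂ (edge k))
    walkFrom-alternating k (suc zero)    = proj₂ (red→blue (red-sym (proj₂ (proj₂ (edge k)))))
    walkFrom-alternating k (suc (suc t)) = walkFrom-alternating (suc k) t

    walkFrom-twice : ∀ m k → walkFrom k (twice m) ≡ proj₁ (edge (m + k))
    walkFrom-twice zero    k = refl
    walkFrom-twice (suc m) k = trans (walkFrom-twice m (suc k)) (cong (proj₁ ∘ edge) (+-suc m k))

    -- Among the first n + 1 red edges two start at the same vertex.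
    repeat = pigeonhole (n<1+n n) (λ (k : Fin (suc n)) → proj₁ (edge (toℕ k)))
    p = toℕ (proj₁ repeat)
    q = toℕ (proj₁ (proj₂ repeat))
    p<q : p < q
    p<q = proj₁ (proj₂ (proj₂ repeat))
    same-start : proj₁ (edge p) ≡ proj₁ (edge q)
    same-start = proj₂ (proj₂ (proj₂ repeat))
    m = q ∸ suc p

    closed : walkFrom p (twice (suc m)) ≡ walkFrom p 0
    closed = begin
      walkFrom p (twice (suc m))  ≡⟨ walkFrom-twice (suc m) p ⟩
      proj₁ (edge (suc m + p))    ≡⟨ cong (proj₁ ∘ edge) (trans (sym (+-suc m p)) (m∸n+n≡m p<q)) ⟩
      proj₁ (edge q)              ≡⟨ same-start ⟨
      walkFrom p 0                ∎
      where open ≡-Reasoning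

SameDegrees : ∀ {n} → Graph n → Graph n → Set
SameDegrees M N = ∀ u → degree M u ≡ degree N u

Closest : ∀ {n} → Graph n → Graph n → Set
Closest M N = ∀ M′ → SameDegrees M′ M → distance M′ N < distance M N → ⊥

record Diff {n} (M N : Graph n) (x y : Fin n) : Set where
  constructor _,_
  field
    present : adj M x y ≡ true
    absent  : adj N x y ≡ false
open Diff

diff-sym : ∀ {n} {M N : Graph n} {x y} → Diff M N x y → Diff M N y x
diff-sym {M = M} {N} {x} {y} (xy∈M , xy∉N) = trans (symmetric M y x) xy∈M , trans (symmetric N y x) xy∉N

diff⇒disagree : ∀ {n} {M N : Graph n} {x y} → Diff M N x y → Disagree M N x y
diff⇒disagree (xy∈M , xy∉N) rewrite xy∈M | xy∉N = refl

diff⇒disagree′ : ∀ {n} {M N : Graph n} {x y} → Diff M N x y → Disagree N M x y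
diff⇒disagree′ (xy∈M , xy∉N) rewrite xy∈M | xy∉N = refl

-- Otherwise a 2-switch in M
-- (if xw ∉ M) or in N (if xw ∈ N) would bring the two graphs closer.
shortcut : ∀ {n} {M N : Graph n} → Closest M N → Closest N M →
  ∀ {x y z w} → Diff M N x y → Diff N M y z → Diff M N z w → x ≢ w → Diff M N x w
shortcut {M = M} {N} closestM closestN {x} {y} {z} {w} xy yz zw x≢w with adj M x w in M-xw
... | false = ⊥-elim (closestM (switched sqM) (switch-degree sqM)
                        (switch-distance sqM N (diff⇒disagree xy) (diff⇒disagree′ yz) (inj₁ (diff⇒disagree zw))))
  where
  open Switch using (switched; switch-degree; switch-distance)
  sqM : Square M x y z w
  sqM = record { ab∈M = present xy ; cd∈M = present zw ; bc∉M = absent yz ; ad∉M = M-xw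
               ; b≢c = edge-distinct N (present yz) ; a≢d = x≢w }
... | true with adj N x w in N-xw
...   | false = M-xw , N-xw
...   | true  = ⊥-elim (closestN (switched sqN) (switch-degree sqN)
                          (switch-distance sqN M (diff⇒disagree yz) (diff⇒disagree′ zw)
                                           (inj₂ (diff⇒disagree′ (diff-sym xy)))))
  where
  open Switch using (switched; switch-degree; switch-distance)
  sqN : Square N y z w x
  sqN = record { ab∈M = present yz ; cd∈M = trans (symmetric N w x) N-xw ; bc∉M = absent zw
               ; ad∉M = absent (diff-sym xy) ; b≢c = edge-distinct M (present zw)
               ; a≢d = edge-distinct M (present xy) ∘ sym }

surplus-edge : ∀ {n} {A B : Graph n} {v t} → degree A v ≤ degree B v → Diff A B v t → ∃ (Diff B A v)
surplus-edge {A = A} {B} {v} {t} A≤B vt =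
  let (s , B-vs , A-vs) = count-witness (adj B v) (adj A v) t (present vt) (absent vt) counts
  in s , (B-vs , A-vs)
  where
  counts : count (adj A v) ≤ count (adj B v)
  counts = subst₂ _≤_ (degree≡count A v) (degree≡count B v) A≤B

-- For a pair (A′, B′) of such graphs at minimal distance, with
-- xy ∈ A′ ∖ B′, colour B′ ∖ A′ red and A′ ∖ B′ blue: the degree condition gives
-- every vertex on a red edge a blue edge and vice versa (xy itself serves at
-- x and y), and minimality makes both colours closed under shortcuts, which
-- contradicts the absence of closed alternating walks.
exchange : ∀ {n} {x y : Fin n} → x ≢ y → (A B : Graph n) →
  (∀ u → degree B u ≡ degree A u + ends x y u) →
  ¬ (∀ A′ → SameDegrees A′ A → adj A′ x y ≡ true)
exchange {n} {x} {y} x≢y A B B-degrees forced =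
  minimal A B (λ _ → refl) (λ _ → refl) (<-wellFounded (distance A B))
  where
  minimal : ∀ A′ B′ → SameDegrees A′ A → SameDegrees B′ B → Acc _<_ (distance A′ B′) → ⊥
  minimal A′ B′ A′~A B′~B (acc closer) with adj B′ x y in B′-xy
  ... | true = false≢true (trans (sym (trans (toggleEdge-pair B′ x y x≢y) (cong not B′-xy))) (forced B″ B″~A))
    where
    -- Deleting xy from B′ leaves a graph with the degrees of A that avoids xy.
    B″ = toggleEdge B′ x y x≢y
    B″~A : SameDegrees B″ A
    B″~A u = +-cancelʳ-≡ (ends x y u) _ _
      (trans (degree-remove B′ x≢y B′-xy u) (trans (B′~B u) (B-degrees u)))
  ... | false = AlternatingWalks.no-red-edge Red Blue diff-sym diff-sym disjoint
                  (shortcut closestB′ closestA′) (shortcut closestA′ closestB′)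
                  red→blue blue→red (proj₂ (blue→red xy-blue))
    where
    Red Blue : Fin n → Fin n → Set
    Red  = Diff B′ A′
    Blue = Diff A′ B′

    disjoint : ∀ {u v} → Red u v → Blue u v → ⊥
    disjoint uv-red uv-blue = false≢true (trans (sym (absent uv-red)) (present uv-blue))

    closestA′ : Closest A′ B′
    closestA′ A″ A″~A′ nearer = minimal A″ B′ (λ u → trans (A″~A′ u) (A′~A u)) B′~B (closer nearer)

    closestB′ : Closest B′ A′
    closestB′ B″ B″~B′ nearer = minimal A′ B″ A′~A (λ u → trans (B″~B′ u) (B′~B u))
      (closer (subst₂ _<_ (distance-sym B″ A′) (distance-sym B′ A′) nearer))

    B′-degrees : ∀ u → degree B′ u ≡ degree A′ u + ends x y u
    B′-degrees u = trans (B′~B u) (trans (B-degrees u) (cong (_+ ends x y u) (sym (A′~A u))))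

    xy-blue : Blue x y
    xy-blue = forced A′ A′~A , B′-xy

    -- Away from x and y the two graphs have equal degrees, so a red edge
    -- forces a blue one; at x and y the blue edge xy is available.
    red→blue : ∀ {v t} → Red v t → ∃ (Blue v)
    red→blue {v} vt-red with v ≟ x | v ≟ y
    ... | yes refl | _        = y , xy-blue
    ... | no _     | yes refl = x , diff-sym xy-blue
    ... | no v≢x   | no v≢y   = surplus-edge (≤-reflexive B′≡A′) vt-red
      where
      B′≡A′ : degree B′ v ≡ degree A′ v
      B′≡A′ = trans (B′-degrees v) (trans (cong (degree A′ v +_) (ends-outside v≢x v≢y)) (+-identityʳ _))

    -- Every degree of B′ is at least that of A′, so a blue edge forces a red one.
    blue→red : ∀ {v t} → Blue v t → ∃ (Red v)
    blue→red {v} = surplus-edge (subst (degree A′ v ≤_) (sym (B′-degrees v)) (m≤m+n _ _))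

minus-plus-one : ∀ k → k ℤ.+ ℤ.- ℤ.1ℤ ℤ.+ ℤ.1ℤ ≡ k
minus-plus-one k = trans (ℤ.+-assoc k (ℤ.- ℤ.1ℤ) ℤ.1ℤ) (ℤ.+-identityʳ k)

d⁺-ends : ∀ {n} (d : Seq n) {i j} → i ≢ j → ∀ u → d⁺ d i j u ≡ d u ℤ.+ ℤ.+ ends i j u
d⁺-ends d {i} {j} i≢j u with u ≟ i | u ≟ j
... | yes refl | yes refl = ⊥-elim (i≢j refl)
... | yes _    | no _     = refl
... | no _     | yes _    = refl
... | no _     | no _     = sym (ℤ.+-identityʳ (d u))

d⁻-ends : ∀ {n} (d : Seq n) {i j} → i ≢ j → ∀ u → d⁻ d i j u ℤ.+ ℤ.+ ends i j u ≡ d u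
d⁻-ends d {i} {j} i≢j u with u ≟ i | u ≟ j
... | yes refl | yes refl = ⊥-elim (i≢j refl)
... | yes _    | no _     = minus-plus-one (d u)
... | no _     | yes _    = minus-plus-one (d u)
... | no _     | no _     = ℤ.+-identityʳ (d u)

realizes-d⁺ : ∀ {n} {d : Seq n} {i j} → i ≢ j → (G H : Graph n) → Realizes G d →
  (∀ u → degree H u ≡ degree G u + ends i j u) ⇔ Realizes H (d⁺ d i j)
realizes-d⁺ {d = d} {i} {j} i≢j G H G-realizes = mk⇔ to from
  where
  to : (∀ u → degree H u ≡ degree G u + ends i j u) → Realizes H (d⁺ d i j)
  to H-degrees u = trans (cong ℤ.+_ (H-degrees u))
                         (trans (cong (ℤ._+ ℤ.+ ends i j u) (G-realizes u)) (sym (d⁺-ends d i≢j u)))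
  from : Realizes H (d⁺ d i j) → ∀ u → degree H u ≡ degree G u + ends i j u
  from H-realizes u = ℤ.+-injective
    (trans (H-realizes u) (trans (d⁺-ends d i≢j u) (cong (ℤ._+ ℤ.+ ends i j u) (sym (G-realizes u)))))

realizes-d⁻ : ∀ {n} {d : Seq n} {i j} → i ≢ j → (G H : Graph n) → Realizes G d →
  (∀ u → degree G u ≡ degree H u + ends i j u) ⇔ Realizes H (d⁻ d i j)
realizes-d⁻ {d = d} {i} {j} i≢j G H G-realizes = mk⇔ to from
  where
  to : (∀ u → degree G u ≡ degree H u + ends i j u) → Realizes H (d⁻ d i j)
  to G-degrees u = ∙-cancelʳ (ℤ.+ ends i j u) _ _
    (trans (cong ℤ.+_ (sym (G-degrees u))) (trans (G-realizes u) (sym (d⁻-ends d i≢j u))))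
  from : Realizes H (d⁻ d i j) → ∀ u → degree G u ≡ degree H u + ends i j u
  from H-realizes u = ℤ.+-injective
    (trans (G-realizes u) (trans (sym (d⁻-ends d i≢j u)) (cong (ℤ._+ ℤ.+ ends i j u) (sym (H-realizes u)))))

realizes-same-degrees : ∀ {n} {d : Seq n} (G H : Graph n) → SameDegrees H G → Realizes G d → Realizes H d
realizes-same-degrees G H H~G G-realizes ℓ = trans (cong ℤ.+_ (H~G ℓ)) (G-realizes ℓ)

-- If some realization of d avoids ij, adding ij realizes d⁺(i,j); so when
-- d⁺(i,j) is not graphic, ij is forced.
d⁺-not-graphic⇒forced : ∀ {n} {d : Seq n} {i j} → i ≢ j → ¬ Graphic (d⁺ d i j) → ForcedEdge d i j
d⁺-not-graphic⇒forced {i = i} {j} i≢j not-d⁺ (R , R-realizes) with adj R i j in R-ij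
... | true  = refl
... | false = ⊥-elim (not-d⁺ (R⁺ , Equivalence.to (realizes-d⁺ i≢j R R⁺ R-realizes) (degree-add R i≢j R-ij)))
  where R⁺ = toggleEdge R i j i≢j

-- If some realization of d contains ij, deleting ij realizes d⁻(i,j); so when
-- d⁻(i,j) is not graphic, ij is a forced non-edge.
d⁻-not-graphic⇒forced : ∀ {n} {d : Seq n} {i j} → i ≢ j → ¬ Graphic (d⁻ d i j) → ForcedNonEdge d i j
d⁻-not-graphic⇒forced {i = i} {j} i≢j not-d⁻ (R , R-realizes) with adj R i j in R-ij
... | false = refl
... | true  = ⊥-elim (not-d⁻ (R⁻ , Equivalence.to (realizes-d⁻ i≢j R R⁻ R-realizes) R⁻-degrees))
  where
  R⁻ = toggleEdge R i j i≢j
  R⁻-degrees : ∀ u → degree R u ≡ degree R⁻ u + ends i j u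
  R⁻-degrees u = sym (degree-remove R i≢j R-ij u)

d⁺-graphic⇒unforced : ∀ {n} {d : Seq n} {i j} → i ≢ j → Graphic d → Graphic (d⁺ d i j) → ¬ ForcedEdge d i j
d⁺-graphic⇒unforced i≢j (G , G-realizes) (H , H-realizes) forced =
  exchange i≢j G H (Equivalence.from (realizes-d⁺ i≢j G H G-realizes) H-realizes)
    λ A A~G → forced (A , realizes-same-degrees G A A~G G-realizes)

-- If d and d⁻(i,j) are both graphic, exchange yields a graph H′ with the
-- degrees of a realization H of d⁻(i,j) that avoids ij; adding ij to H′
-- realizes d with the edge ij.
d⁻-graphic⇒unforced : ∀ {n} {d : Seq n} {i j} → i ≢ j → Graphic d → Graphic (d⁻ d i j) → ¬ ForcedNonEdge d i j
d⁻-graphic⇒unforced {d = d} {i} {j} i≢j (G , G-realizes) (H , H-realizes) forced =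
  exchange i≢j H G H-to-G ij-in-every-H
  where
  H-to-G = Equivalence.from (realizes-d⁻ i≢j G H G-realizes) H-realizes
  ij-in-every-H : ∀ A → SameDegrees A H → adj A i j ≡ true
  ij-in-every-H A A~H with adj A i j in A-ij
  ... | true  = refl
  ... | false = ⊥-elim (false≢true (trans (sym (forced (A⁺ , A⁺-realizes)))
                                          (trans (toggleEdge-pair A i j i≢j) (cong not A-ij))))
    where
    A⁺ = toggleEdge A i j i≢j
    A⁺~G : SameDegrees A⁺ G
    A⁺~G u = trans (degree-add A i≢j A-ij u) (trans (cong (_+ ends i j u) (A~H u)) (sym (H-to-G u)))
    A⁺-realizes : Realizes A⁺ d
    A⁺-realizes = realizes-same-degrees G A⁺ A⁺~G G-realizes

theorem2p1 : (n : ℕ) (d : Seq n) → NonIncreasing d → Graphic d →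
    (i j : Fin n) → toℕ i < toℕ j →
    (ForcedEdge d i j ⇔ (¬ Graphic (d⁺ d i j))) ×
    (ForcedNonEdge d i j ⇔ (¬ Graphic (d⁻ d i j)))
theorem2p1 n d _ d-graphic i j i<j =
  mk⇔ (λ forced d⁺-graphic → d⁺-graphic⇒unforced i≢j d-graphic d⁺-graphic forced) (d⁺-not-graphic⇒forced i≢j) ,
  mk⇔ (λ forced d⁻-graphic → d⁻-graphic⇒unforced i≢j d-graphic d⁻-graphic forced) (d⁻-not-graphic⇒forced i≢j)
  where
  i≢j : i ≢ j
  i≢j i≡j = <-irrefl (cong toℕ i≡j) i<j
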